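{- Let $G$ be a finite simple $2$-connected graph and let $k \geq 3$ be an integer. If the degree of every vertex of $G$ is divisible by $k$, then every edge of $G$ is contained in a cycle of even length.
   Context: Graphs are finite, simple (no loops, no multiple edges). A graph is $2$-connected if it has more than $2$ vertices and remains connected whenever fewer than $2$ vertices are removed. The length of a cycle is its number of edges. -}

module Defs where

open import Data.Nat using (ℕ; _<_; _≤_)
open import Data.Fin using (Fin)
open import Data.Bool using (Bool; true; false)
open import Data.List using (List; []; _∷_; length; filter; head; last; allFin)
open import Data.List.Relation.Unary.All using (All)
open import Data.List.Relation.Unary.Unique.Propositional using (Unique)
open import Data.List.Relation.Unary.Linked using (Linked)
open import Data.Maybe using (just)
open import Data.Bool using (T)
open import Relation.Binary.PropositionalEquality using (_≡_)
open import Relation.Nullary using (¬_)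
open import Data.Product using (Σ; _×_)

-- A finite simple graph on vertex set Fin n: symmetric, loopless adjacency relation
-- (a simple graph has no multiple edges by construction of a relation).
record Graph (n : ℕ) : Set where
  field
    adj    : Fin n → Fin n → Bool
    sym    : ∀ u v → adj u v ≡ adj v u
    irrefl : ∀ v → adj v v ≡ false
open Graph public

Adj : ∀ {n} → Graph n → Fin n → Fin n → Set
Adj G u v = T (adj G u v)

degree : ∀ {n} → Graph n → Fin n → ℕ
degree {n} G v = length (filter (λ u → Data.Bool._≟_ (adj G v u) true) (allFin n))

record Walk {n} (G : Graph n) (u v : Fin n) : Set where
  field
    verts  : List (Fin n)
    start  : head verts ≡ just u
    end    : last verts ≡ just v
    linked : Linked (Adj G) verts
open Walk public

-- G − X is connected, where X is the set of removed vertices (given as a predicate):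
-- any two vertices outside X are joined by a walk avoiding X.
ConnectedAvoiding : ∀ {n} → Graph n → (Fin n → Set) → Set
ConnectedAvoiding {n} G X =
  ∀ (u v : Fin n) → ¬ X u → ¬ X v →
  Σ (Walk G u v) (λ w → All (λ x → ¬ X x) (verts w))

Connected : ∀ {n} → Graph n → Set
Connected G = ConnectedAvoiding G (λ _ → Data.Empty.⊥)
  where import Data.Empty

-- 2-connected: more than 2 vertices, and connected after removing fewer than 2 vertices
TwoConnected : ∀ {n} → Graph n → Set
TwoConnected {n} G =
  2 < n × Connected G × (∀ (w : Fin n) → ConnectedAvoiding G (λ x → x ≡ w))

-- A cycle: a list of ≥ 3 distinct vertices v₁ … vₘ with consecutive vertices adjacent
-- and vₘ adjacent to v₁; its length (number of edges) is m.
record Cycle {n} (G : Graph n) : Set where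
  field
    cverts  : List (Fin n)
    long    : 3 ≤ length cverts
    unique  : Unique cverts
    clinked : Linked (Adj G) cverts
    closed  : ∀ a b → head cverts ≡ just a → last cverts ≡ just b → Adj G b a
open Cycle public

cycleLength : ∀ {n} {G : Graph n} → Cycle G → ℕ
cycleLength c = length (cverts c)

-- the edge uv lies on cycle c: it is the closing edge for some enumeration of c,
-- i.e. c can be listed starting at u and ending at v.
-- (Every cycle through uv can be enumerated this way, up to rotation/reversal.)
EdgeOnCycle : ∀ {n} {G : Graph n} → Fin n → Fin n → Cycle G → Set
EdgeOnCycle u v c = head (cverts c) ≡ just u × last (cverts c) ≡ just v

-- Grow a vertex set S ∋ u, v with a colouring c, c u = c v = true, such that any two distinct
-- vertices of S are reached from u and from v by disjoint properly coloured paths inside S.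
-- While S ≠ V, 2-connectivity yields an ear of S; the two paths to its ends, the ear and the
-- edge vu form a cycle, which is even unless the ear has the wrong parity, and in that case
-- colouring the ear alternately preserves the invariant for S ∪ ear. Once S = V, a
-- monochromatic edge other than uv closes an even cycle in the same way; if there is none, c
-- properly colours G − uv, and comparing the degree sums of the two colour classes gives k ∣ 2.
module Submission where

open import Defs renaming (sym to adj-sym)
open import Data.Nat using (ℕ; _≤_)
open import Data.Nat.Divisibility using (_∣_)
open import Data.Fin using (Fin)
open import Data.Product using (Σ; _×_)

open import Data.Nat.Properties using (+-0-commutativeMonoid)
open import Algebra.Properties.CommutativeMonoid.Sum +-0-commutativeMonoid
  using (sum-syntax; ∑-comm; ∑-distrib-+; sum-cong-≗; sum-replicate-zero)
open import Data.Bool using (Bool; true; false; not; _∧_; _xor_; if_then_else_; T)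
import Data.Bool as Bool
open import Data.Bool.Properties
  using (not-involutive; not-distribˡ-xor; xor-same; xor-comm; xor-assoc; ¬-not; not-¬; ∧-zeroʳ; T?)
open import Data.Empty using (⊥; ⊥-elim)
open import Data.Fin using (zero; suc)
open import Data.Fin.Properties using (_≟_; suc-injective; any?; all?; ¬∀⟶∃¬)
open import Data.Fin.Subset using (Subset; ⁅_⁆; _∪_; _⊂_; _⊃_) renaming (⊥ to ∅; _∈_ to _∈ₛ_; _∉_ to _∉ₛ_)
open import Data.Fin.Subset.Induction using (Acc; acc; ⊃-wellFounded)
open import Data.Fin.Subset.Properties using (∉⊥; x∈⁅x⁆; x∈⁅y⁆⇒x≡y; p⊆p∪q; q⊆p∪q; x∈p∪q⁻)
  renaming (_∈?_ to _∈ₛ?_)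
open import Data.List using (List; []; _∷_; _++_; [_]; length; head; last; reverse; foldr; filter; tabulate)
open import Data.List.Membership.Propositional using (_∈_; _∉_)
open import Data.List.Membership.Propositional.Properties using (∈-++⁺ʳ; ∈-++⁻)
open import Data.List.Properties using (length-++; length-reverse; unfold-reverse)
open import Data.List.Relation.Binary.Disjoint.Propositional using (Disjoint)
open import Data.List.Relation.Binary.Subset.Propositional using (_⊆_)
open import Data.List.Relation.Unary.All as All using (All; []; _∷_)
open import Data.List.Relation.Unary.All.Properties using (¬Any⇒All¬; All¬⇒¬Any) renaming (++⁺ to All-++⁺)
open import Data.List.Relation.Unary.AllPairs using ([]; _∷_)
open import Data.List.Relation.Unary.Any using (here; there)
open import Data.List.Relation.Unary.Any.Properties using (reverse⁻)
open import Data.List.Relation.Unary.Linked using (Linked; [-]; _∷_)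
open import Data.List.Relation.Unary.Unique.Propositional using (Unique)
open import Data.List.Relation.Unary.Unique.Propositional.Properties using (++⁺)
open import Data.Maybe using (just)
open import Data.Maybe.Properties using (just-injective)
open import Data.Nat using (zero; suc; _+_; s≤s; z≤n)
open import Data.Nat.Divisibility using (divides; _∣0; ∣m+n∣m⇒∣n; ∣m∣n⇒∣m+n; >⇒∤)
open import Data.Nat.Properties using (+-identityʳ; +-comm; +-mono-≤; ≤-trans; m≤n+m)
open import Data.Product using (_,_; proj₁)
open import Data.Sum as Sum using (_⊎_; inj₁; inj₂; swap)
open import Function using (_∘_; id)
open import Relation.Binary.Definitions using (DecidableEquality)
open import Relation.Binary.PropositionalEquality
  using (_≡_; _≢_; refl; sym; trans; cong; cong₂; subst; ≢-sym; module ≡-Reasoning)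
open import Relation.Nullary using (¬_; Dec; yes; no; does; ¬?)
open import Relation.Nullary.Decidable using (dec-true; dec-false; _×-dec_)
open import Relation.Unary using (Decidable)

private
  variable
    A : Set
    a b x y y′ : A
    xs ys : List A

Unique-reverse : Unique xs → Unique (reverse xs)
Unique-reverse {xs = []} [] = []
Unique-reverse {xs = x ∷ xs} (x∉xs ∷ u) =
  subst Unique (sym (unfold-reverse x xs))
    (++⁺ (Unique-reverse u) ([] ∷ []) λ { (x∈ , here refl) → All.lookup x∉xs (reverse⁻ x∈) refl })

Unique-++⁻ʳ : ∀ xs → Unique (xs ++ ys) → Unique ys
Unique-++⁻ʳ []       u       = u
Unique-++⁻ʳ (_ ∷ xs) (_ ∷ u) = Unique-++⁻ʳ xs u

-- The index xs lists all vertices of the path, both ends included.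
data Path {A : Set} (R : A → A → Set) : A → A → List A → Set where
  stop : Path R x x [ x ]
  _∷_ : R x y → Path R y y′ xs → Path R x y′ (x ∷ xs)

module _ {R : A → A → Set} where

  start∈ : Path R x y xs → x ∈ xs
  start∈ stop    = here refl
  start∈ (_ ∷ _) = here refl

  end∈ : Path R x y xs → y ∈ xs
  end∈ stop    = here refl
  end∈ (_ ∷ p) = there (end∈ p)

  Path-length : Path R x y xs → 1 ≤ length xs
  Path-length stop    = s≤s z≤n
  Path-length (_ ∷ _) = s≤s z≤n

  Path-length-≢ : Path R x y xs → x ≢ y → 2 ≤ length xs
  Path-length-≢ stop    x≢x = ⊥-elim (x≢x refl)
  Path-length-≢ (_ ∷ p) _   = s≤s (Path-length p)

  Path-head : Path R x y xs → head xs ≡ just x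
  Path-head stop    = refl
  Path-head (_ ∷ _) = refl

  Path-last : Path R x y xs → last xs ≡ just y
  Path-last stop            = refl
  Path-last (_ ∷ stop)      = refl
  Path-last (_ ∷ p@(_ ∷ _)) = Path-last p

  Path-linked : Path R x y xs → Linked R xs
  Path-linked stop            = [-]
  Path-linked (r ∷ stop)      = r ∷ [-]
  Path-linked (r ∷ p@(_ ∷ _)) = r ∷ Path-linked p

  Linked⇒Path : ∀ xs → head xs ≡ just x → last xs ≡ just y → Linked R xs → Path R x y xs
  Linked⇒Path (_ ∷ [])     refl refl _       = stop
  Linked⇒Path (_ ∷ _ ∷ xs) refl eq   (r ∷ l) = r ∷ Linked⇒Path (_ ∷ xs) refl eq l

  Path-++ : Path R x y xs → Path R y y′ (y ∷ ys) → Path R x y′ (xs ++ ys)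
  Path-++ stop    q = q
  Path-++ (r ∷ p) q = r ∷ Path-++ p q

  Path-reverse : (∀ {a b} → R a b → R b a) → Path R x y xs → Path R y x (reverse xs)
  Path-reverse sym-R stop = stop
  Path-reverse sym-R (_∷_ {x = x} {xs = xs} r p) =
    subst (Path R _ _) (sym (unfold-reverse x xs)) (Path-++ (Path-reverse sym-R p) (sym-R r ∷ stop))

  Path-prefix : Path R x y xs → a ∈ xs → Σ (List A) λ ys → Path R x a ys × ys ⊆ xs
  Path-prefix stop    (here refl) = [ _ ] , stop , λ b∈ → b∈
  Path-prefix (_ ∷ _) (here refl) = [ _ ] , stop , λ { (here refl) → here refl }
  Path-prefix (r ∷ p) (there a∈xs) with Path-prefix p a∈xs
  ... | ys , q , ys⊆xs = _ ∷ ys , r ∷ q , λ { (here refl) → here refl ; (there b∈) → there (ys⊆xs b∈) }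

  Path-suffix : Path R x y xs → a ∈ xs → Σ (List A) λ zs → Σ (List A) λ ys → xs ≡ zs ++ ys × Path R a y ys
  Path-suffix p@stop    (here refl) = [] , _ , refl , p
  Path-suffix p@(_ ∷ _) (here refl) = [] , _ , refl , p
  Path-suffix (r ∷ p) (there a∈xs) with Path-suffix p a∈xs
  ... | zs , ys , refl , q = _ ∷ zs , ys , refl , q

module _ {R : A → A → Set} {R′ : A → A → Set} where

  Path-map : (∀ {a b} → R a b → R′ a b) → Path R x y xs → Path R′ x y xs
  Path-map f stop    = stop
  Path-map f (r ∷ p) = f r ∷ Path-map f p

  Path-mapᴾ : {P : A → Set} → (∀ {a b} → P a → P b → R a b → R′ a b) →
              All P xs → Path R x y xs → Path R′ x y xs
  Path-mapᴾ f _          stop    = stop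
  Path-mapᴾ f (pa ∷ pas) (r ∷ p) = f pa (All.lookup pas (start∈ p)) r ∷ Path-mapᴾ f pas p

module _ {R : A → A → Set} where

  record Separation (x y a b : A) (xs : List A) : Set where
    field
      front back : List A
      front-path : Path R x a front
      back-path  : Path R b y back
      front⊆     : front ⊆ xs
      back⊆      : back ⊆ xs
      apart      : Disjoint front back

  private
    separate-at-start : x ∉ xs → Path R y y′ xs → b ∈ xs → Separation x y′ x b (x ∷ xs)
    separate-at-start x∉xs p b∈xs with Path-suffix p b∈xs
    ... | zs , ys , refl , q = record
      { front = [ _ ] ; back = ys ; front-path = stop ; back-path = q
      ; front⊆ = λ { (here refl) → here refl } ; back⊆ = there ∘ ∈-++⁺ʳ zs
      ; apart  = λ { (here refl , a∈ys) → x∉xs (∈-++⁺ʳ zs a∈ys) } }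

    separate-prepend : x ∉ xs → R x y → Separation y y′ a b xs → Separation x y′ a b (x ∷ xs)
    separate-prepend x∉xs r S = record
      { front = _ ∷ front ; back = back ; front-path = r ∷ front-path ; back-path = back-path
      ; front⊆ = λ { (here refl) → here refl ; (there c∈) → there (front⊆ c∈) }
      ; back⊆  = there ∘ back⊆
      ; apart  = λ { (here refl , c∈) → x∉xs (back⊆ c∈) ; (there c∈ , c∈′) → apart (c∈ , c∈′) } }
      where open Separation S

  separate : Path R x y xs → Unique xs → a ∈ xs → b ∈ xs → a ≢ b →
             Separation x y a b xs ⊎ Separation x y b a xs
  separate stop    _          (here refl) (here refl) a≢b = ⊥-elim (a≢b refl)
  separate (_ ∷ _) _          (here refl) (here refl) a≢b = ⊥-elim (a≢b refl)
  separate (_ ∷ p) (x∉ ∷ _)   (here refl) (there b∈)  _   = inj₁ (separate-at-start (All¬⇒¬Any x∉) p b∈)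
  separate (_ ∷ p) (x∉ ∷ _)   (there a∈)  (here refl) _   = inj₂ (separate-at-start (All¬⇒¬Any x∉) p a∈)
  separate (r ∷ p) (x∉ ∷ u)   (there a∈)  (there b∈)  a≢b =
    Sum.map (separate-prepend (All¬⇒¬Any x∉) r) (separate-prepend (All¬⇒¬Any x∉) r)
            (separate p u a∈ b∈ a≢b)

  record Entry (P : A → Set) (x : A) (xs : List A) : Set where
    field
      {exit entry} : A
      prefix       : List A
      prefix-path  : Path R x exit prefix
      step         : R exit entry
      entry-in     : P entry
      prefix-out   : All (¬_ ∘ P) prefix
      entry∈       : entry ∈ xs

  first-entry : {P : A → Set} → Decidable P → Path R x y xs → ¬ P x → P y → Entry P x xs
  first-entry P? stop ¬Px Py = ⊥-elim (¬Px Py)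
  first-entry P? (_∷_ {y = x′} r p) ¬Px Py with P? x′
  ... | yes Px′ = record { prefix = [ _ ] ; prefix-path = stop ; step = r ; entry-in = Px′
                         ; prefix-out = ¬Px ∷ [] ; entry∈ = there (start∈ p) }
  ... | no ¬Px′ = record { prefix = _ ∷ prefix ; prefix-path = r ∷ prefix-path ; step = step
                         ; entry-in = entry-in ; prefix-out = ¬Px ∷ prefix-out ; entry∈ = there entry∈ }
    where E = first-entry P? p ¬Px′ Py
          open Entry E

  module _ (_≟_ : DecidableEquality A) where
    open import Data.List.Membership.DecPropositional _≟_ using (_∈?_)

    loop-erase : Path R x y xs → Σ (List A) λ ys → Path R x y ys × Unique ys × ys ⊆ xs
    loop-erase stop = [ _ ] , stop , [] ∷ [] , λ a∈ → a∈
    loop-erase {x = x} (r ∷ p) with loop-erase p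
    ... | ys , q , u , ys⊆ with x ∈? ys
    ...   | no x∉ys = _ ∷ ys , r ∷ q , ¬Any⇒All¬ ys x∉ys ∷ u
                    , λ { (here refl) → here refl ; (there a∈) → there (ys⊆ a∈) }
    ...   | yes x∈ys with Path-suffix q x∈ys
    ...     | zs , ws , refl , q′ = ws , q′ , Unique-++⁻ʳ zs u , there ∘ ys⊆ ∘ ∈-++⁺ʳ zs

odd : ℕ → Bool
odd zero    = false
odd (suc n) = not (odd n)

odd-+ : ∀ m n → odd (m + n) ≡ odd m xor odd n
odd-+ zero    n = refl
odd-+ (suc m) n = trans (cong not (odd-+ m n)) (not-distribˡ-xor (odd m) (odd n))

odd≡false⇒2∣ : ∀ n → odd n ≡ false → 2 ∣ n
odd≡false⇒2∣ zero          _ = 2 ∣0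
odd≡false⇒2∣ (suc (suc n)) e with odd≡false⇒2∣ n (trans (sym (not-involutive (odd n))) e)
... | divides q n≡q*2 = divides (suc q) (cong (2 +_) n≡q*2)

Proper : (A → A → Set) → (A → Bool) → A → A → Set
Proper R c x y = R x y × c x ≢ c y

module _ {R : A → A → Set} {c : A → Bool} where
  open ≡-Reasoning

  Proper-parity : Path (Proper R c) x y xs → odd (length xs) ≡ not (c x xor c y)
  Proper-parity {x = x} stop = cong not (sym (xor-same (c x)))
  Proper-parity {y = y} (_∷_ {x = x} {y = x′} {xs = xs} (_ , cx≢cx′) p) = begin
    not (odd (length xs))    ≡⟨ cong not (Proper-parity p) ⟩
    not (not (c x′ xor c y)) ≡⟨ not-involutive _ ⟩
    c x′ xor c y             ≡⟨ cong (_xor c y) (¬-not (≢-sym cx≢cx′)) ⟩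
    not (c x) xor c y        ≡⟨ not-distribˡ-xor (c x) (c y) ⟨
    not (c x xor c y)        ∎

module _ (_≟_ : DecidableEquality A) where

  alternate : (A → Bool) → Bool → List A → A → Bool
  alternate c b []       x = c x
  alternate c b (y ∷ ys) x = if does (x ≟ y) then b else alternate c (not b) ys x

  module _ {c : A → Bool} where

    alternate-∉ : ∀ {b} ys → x ∉ ys → alternate c b ys x ≡ c x
    alternate-∉     []       _     = refl
    alternate-∉ {x} (y ∷ ys) x∉ with x ≟ y
    ... | yes refl = ⊥-elim (x∉ (here refl))
    ... | no _     = alternate-∉ ys (x∉ ∘ there)

    alternate-≢ : ∀ {b} ys → x ≢ y → alternate c b (y ∷ ys) x ≡ alternate c (not b) ys x
    alternate-≢ {x} {y} ys x≢y with x ≟ y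
    ... | yes x≡y = ⊥-elim (x≢y x≡y)
    ... | no _    = refl

    alternate-start : ∀ {R : A → A → Set} {b} → Path R x y xs → alternate c b xs x ≡ b
    alternate-start {x} stop    with x ≟ x
    ... | yes _  = refl
    ... | no x≢x = ⊥-elim (x≢x refl)
    alternate-start {x} (_ ∷ _) with x ≟ x
    ... | yes _  = refl
    ... | no x≢x = ⊥-elim (x≢x refl)

    alternate-proper : ∀ {R : A → A → Set} {b} → Path R x y xs → Unique xs →
                       Path (Proper R (alternate c b xs)) x y xs
    alternate-proper stop _ = stop
    alternate-proper {x} {R = R} {b} (_∷_ {xs = xs} r p) (x∉xs ∷ u) =
      (r , head-proper) ∷ Path-mapᴾ shift x∉xs (alternate-proper p u)
      where
        same : ∀ {a} → x ≢ a → alternate c b (x ∷ xs) a ≡ alternate c (not b) xs a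
        same x≢a = alternate-≢ xs (≢-sym x≢a)

        shift : ∀ {a a′} → x ≢ a → x ≢ a′ →
                Proper R (alternate c (not b) xs) a a′ → Proper R (alternate c b (x ∷ xs)) a a′
        shift x≢a x≢a′ (r′ , ne) = r′ , λ eq → ne (trans (sym (same x≢a)) (trans eq (same x≢a′)))

        head-proper : alternate c b (x ∷ xs) x ≢ alternate c b (x ∷ xs) _
        head-proper eq = not-¬ refl
          (trans (sym (alternate-start (r ∷ p)))
                 (trans eq (trans (same (All.lookup x∉xs (start∈ p))) (alternate-start p))))

true≢false : true ≢ false
true≢false ()

𝟙 : Bool → ℕ
𝟙 true  = 1
𝟙 false = 0

𝟙-split : ∀ q a → 𝟙 a ≡ 𝟙 (q ∧ a) + 𝟙 (not q ∧ a)
𝟙-split true  a = sym (+-identityʳ (𝟙 a))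
𝟙-split false a = refl

𝟙-∧³≡1 : ∀ {p q r} → p ≡ true → q ≡ true → T r → 𝟙 (p ∧ q ∧ r) ≡ 1
𝟙-∧³≡1 {r = true} refl refl _ = refl

𝟙-∧³≡0 : ∀ p q r → (p ≡ true → q ≡ true → T r → ⊥) → 𝟙 (p ∧ q ∧ r) ≡ 0
𝟙-∧³≡0 true  true  true  h = ⊥-elim (h refl refl _)
𝟙-∧³≡0 true  true  false _ = refl
𝟙-∧³≡0 true  false r     _ = refl
𝟙-∧³≡0 false q     r     _ = refl

∧-swap : ∀ p q r → p ∧ (q ∧ r) ≡ q ∧ (p ∧ r)
∧-swap true  q r = refl
∧-swap false q r = sym (∧-zeroʳ q)

∑-zero : ∀ {n} {f : Fin n → ℕ} → (∀ i → f i ≡ 0) → ∑[ i < n ] f i ≡ 0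
∑-zero {n} f≡0 = trans (sum-cong-≗ f≡0) (sum-replicate-zero n)

∑-single : ∀ {n} {f : Fin n → ℕ} a → (∀ i → i ≢ a → f i ≡ 0) → ∑[ i < n ] f i ≡ f a
∑-single {suc n} {f} zero    f≡0 =
  trans (cong (f zero +_) (∑-zero (λ i → f≡0 (suc i) λ ()))) (+-identityʳ _)
∑-single {suc n}     (suc a) f≡0 =
  cong₂ _+_ (f≡0 zero λ ()) (∑-single a λ i i≢a → f≡0 (suc i) (i≢a ∘ suc-injective))

length-filter-tabulate : ∀ {A : Set} {n} (p : A → Bool) (g : Fin n → A) →
  length (filter (λ y → p y Bool.≟ true) (tabulate g)) ≡ ∑[ i < n ] 𝟙 (p (g i))
length-filter-tabulate {n = zero}  p g = refl
length-filter-tabulate {n = suc n} p g with p (g zero)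
... | true  = cong suc (length-filter-tabulate p (g ∘ suc))
... | false = length-filter-tabulate p (g ∘ suc)

∣-∑ : ∀ {k n} {f : Fin n → ℕ} → (∀ i → k ∣ f i) → k ∣ ∑[ i < n ] f i
∣-∑ {k} {zero}  k∣f = k ∣0
∣-∑ {k} {suc n} k∣f = ∣m∣n⇒∣m+n (k∣f zero) (∣-∑ (k∣f ∘ suc))

∑-δ : ∀ {n} (a : Fin n) → ∑[ i < n ] 𝟙 (does (i ≟ a)) ≡ 1
∑-δ a = trans (∑-single a λ i i≢a → cong 𝟙 (dec-false (i ≟ a) i≢a)) (cong 𝟙 (dec-true (a ≟ a) refl))

module _ {n} (G : Graph n) where

  adj-flip : ∀ {x y} → Adj G x y → Adj G y x
  adj-flip {x} {y} = subst T (adj-sym G x y)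

  adj⇒≢ : ∀ {x y} → Adj G x y → x ≢ y
  adj⇒≢ {x} x∼y refl = subst T (irrefl G x) x∼y

  arcs : (Fin n → Bool) → (Fin n → Bool) → ℕ
  arcs P Q = ∑[ x < n ] ∑[ y < n ] 𝟙 (P x ∧ Q y ∧ adj G x y)

  degree≡∑ : ∀ x → degree G x ≡ ∑[ y < n ] 𝟙 (adj G x y)
  degree≡∑ x = length-filter-tabulate (adj G x) (λ y → y)

  arcs-comm : ∀ P Q → arcs P Q ≡ arcs Q P
  arcs-comm P Q = trans (∑-comm {n} {n} (λ x y → 𝟙 (P x ∧ Q y ∧ adj G x y)))
                        (sum-cong-≗ {n} λ y → sum-cong-≗ {n} λ x →
    cong 𝟙 (trans (∧-swap (P x) (Q y) _) (cong (λ b → Q y ∧ P x ∧ b) (adj-sym G x y))))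

  arcs-split : ∀ P Q → arcs P (λ _ → true) ≡ arcs P Q + arcs P (not ∘ Q)
  arcs-split P Q =
    trans (sum-cong-≗ {n} λ x → trans (sum-cong-≗ {n} (split x)) (∑-distrib-+ {n} _ _)) (∑-distrib-+ {n} _ _)
    where
      split : ∀ x y → 𝟙 (P x ∧ true ∧ adj G x y) ≡
                      𝟙 (P x ∧ Q y ∧ adj G x y) + 𝟙 (P x ∧ not (Q y) ∧ adj G x y)
      split x y with P x
      ... | true  = 𝟙-split (Q y) (adj G x y)
      ... | false = refl

  -- arcs P (λ _ → true) is the sum of the degrees of the vertices in P.
  ∣arcs : ∀ {k} P → (∀ x → k ∣ degree G x) → k ∣ arcs P (λ _ → true)
  ∣arcs {k} P k∣deg = ∣-∑ row
    where
      row : ∀ x → k ∣ ∑[ y < n ] 𝟙 (P x ∧ true ∧ adj G x y)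
      row x with P x
      ... | true  = subst (k ∣_) (degree≡∑ x) (k∣deg x)
      ... | false = subst (k ∣_) (sym (∑-zero {n} λ _ → refl)) (k ∣0)

  record ProperExcept (u v : Fin n) (c : Fin n → Bool) : Set where
    field
      u-true  : c u ≡ true
      v-true  : c v ≡ true
      only-uv : ∀ {x y} → Adj G x y → c x ≡ c y → (x ≡ u × y ≡ v) ⊎ (x ≡ v × y ≡ u)

  module _ {u v c} (uv : Adj G u v) (pe : ProperExcept u v c) where
    open ProperExcept pe

    private
      uv-true : ∀ {x y} → (x ≡ u × y ≡ v) ⊎ (x ≡ v × y ≡ u) → c x ≡ true
      uv-true (inj₁ (refl , _)) = u-true
      uv-true (inj₂ (refl , _)) = v-true

      off-uv : ∀ x y → ¬ ((x ≡ u × y ≡ v) ⊎ (x ≡ v × y ≡ u)) → 𝟙 (c x ∧ c y ∧ adj G x y) ≡ 0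
      off-uv x y h = 𝟙-∧³≡0 _ _ _ λ cx cy x∼y → h (only-uv x∼y (trans cx (sym cy)))

      row-true : ∀ x → ∑[ y < n ] 𝟙 (c x ∧ c y ∧ adj G x y) ≡ 𝟙 (does (x ≟ u)) + 𝟙 (does (x ≟ v))
      row-true x with x ≟ u | x ≟ v
      ... | yes refl | yes u≡v = ⊥-elim (adj⇒≢ uv u≡v)
      ... | yes refl | no _    =
        trans (∑-single {n} v λ y y≢v → off-uv u y λ { (inj₁ (_ , y≡v)) → y≢v y≡v
                                                     ; (inj₂ (u≡v , _)) → adj⇒≢ uv u≡v })
              (𝟙-∧³≡1 u-true v-true uv)
      ... | no _     | yes refl =
        trans (∑-single {n} u λ y y≢u → off-uv v y λ { (inj₁ (v≡u , _)) → adj⇒≢ uv (sym v≡u)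
                                                     ; (inj₂ (_ , y≡u)) → y≢u y≡u })
              (𝟙-∧³≡1 v-true u-true (adj-flip uv))
      ... | no x≢u   | no x≢v   =
        ∑-zero {n} λ y → off-uv x y λ { (inj₁ (x≡u , _)) → x≢u x≡u ; (inj₂ (x≡v , _)) → x≢v x≡v }

    arcs-true : arcs c c ≡ 2
    arcs-true = trans (sum-cong-≗ {n} row-true)
                      (trans (∑-distrib-+ {n} (λ x → 𝟙 (does (x ≟ u))) _) (cong₂ _+_ (∑-δ u) (∑-δ v)))

    arcs-false : arcs (not ∘ c) (not ∘ c) ≡ 0
    arcs-false = ∑-zero {n} λ x → ∑-zero {n} λ y → 𝟙-∧³≡0 _ _ _ λ ncx ncy x∼y →
      let cx≡false = trans (sym (not-involutive (c x))) (cong not ncx)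
          cy≡false = trans (sym (not-involutive (c y))) (cong not ncy)
      in true≢false (trans (sym (uv-true (only-uv x∼y (trans cx≡false (sym cy≡false))))) cx≡false)

    -- The degree sums of the two colour classes differ by the two arcs of uv.
    ProperExcept⇒∣2 : ∀ {k} → (∀ x → k ∣ degree G x) → k ∣ 2
    ProperExcept⇒∣2 {k} k∣deg = ∣m+n∣m⇒∣n k∣X+2 k∣X
      where
        X = arcs c (not ∘ c)
        k∣X+2 : k ∣ X + 2
        k∣X+2 = subst (k ∣_) (trans (arcs-split c c) (trans (cong (_+ X) arcs-true) (+-comm 2 X)))
                      (∣arcs c k∣deg)
        k∣X : k ∣ X
        k∣X = subst (k ∣_) (trans (arcs-split (not ∘ c) c)
                                  (trans (cong₂ _+_ (arcs-comm (not ∘ c) c) arcs-false) (+-identityʳ X)))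
                    (∣arcs (not ∘ c) k∣deg)

fromList : ∀ {n} → List (Fin n) → Subset n
fromList = foldr (λ x S → ⁅ x ⁆ ∪ S) ∅

∈-fromList⁺ : ∀ {n} {x : Fin n} {xs} → x ∈ xs → x ∈ₛ fromList xs
∈-fromList⁺ {xs = x ∷ xs} (here refl) = p⊆p∪q (fromList xs) (x∈⁅x⁆ x)
∈-fromList⁺ {xs = y ∷ xs} (there x∈) = q⊆p∪q ⁅ y ⁆ (fromList xs) (∈-fromList⁺ x∈)

∈-fromList⁻ : ∀ {n} {x : Fin n} {xs} → x ∈ₛ fromList xs → x ∈ xs
∈-fromList⁻ {xs = []}     x∈ = ⊥-elim (∉⊥ x∈)
∈-fromList⁻ {xs = y ∷ xs} x∈ with x∈p∪q⁻ ⁅ y ⁆ (fromList xs) x∈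
... | inj₁ x∈y  = here (x∈⁅y⁆⇒x≡y y x∈y)
... | inj₂ x∈xs = there (∈-fromList⁻ x∈xs)

xor-not-not : ∀ a b → a xor not (not a xor b) ≡ b
xor-not-not true  b = not-involutive b
xor-not-not false b = not-involutive b

3≤l+[m+r] : ∀ {l m r} → 1 ≤ l → 1 ≤ r → 2 ≤ l ⊎ 1 ≤ m ⊎ 2 ≤ r → 3 ≤ l + (m + r)
3≤l+[m+r] {_} {m} {r} 1≤l 1≤r (inj₁ 2≤l)        = +-mono-≤ 2≤l (≤-trans 1≤r (m≤n+m r m))
3≤l+[m+r] {_} {m} {r} 1≤l 1≤r (inj₂ (inj₁ 1≤m)) = +-mono-≤ 1≤l (+-mono-≤ 1≤m 1≤r)
3≤l+[m+r] {_} {m} {r} 1≤l 1≤r (inj₂ (inj₂ 2≤r)) = +-mono-≤ 1≤l (≤-trans 2≤r (m≤n+m r m))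

module EvenCycle {n} (G : Graph n) (u v : Fin n) (uv : Adj G u v) where

  private
    V = Fin n

  u≢v : u ≢ v
  u≢v = adj⇒≢ G uv

  EvenCycleThrough : Set
  EvenCycleThrough = Σ (Cycle G) λ c → EdgeOnCycle u v c × 2 ∣ cycleLength c

  even-cycle : ∀ {xs} → Path (Adj G) u v xs → Unique xs → 3 ≤ length xs → odd (length xs) ≡ false →
               EvenCycleThrough
  even-cycle {xs} p xs-unique 3≤ even =
    record { cverts = xs ; long = 3≤ ; unique = xs-unique ; clinked = Path-linked p ; closed = closing }
    , (Path-head p , Path-last p) , odd≡false⇒2∣ (length xs) even
    where
      closing : ∀ a b → head xs ≡ just a → last xs ≡ just b → Adj G b a
      closing a b head≡a last≡b
        with just-injective (trans (sym (Path-head p)) head≡a)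
           | just-injective (trans (sym (Path-last p)) last≡b)
      ... | refl | refl = adj-flip G uv

  record Route (S : Subset n) (c : V → Bool) (x y : V) : Set where
    field
      nodes        : List V
      route        : Path (Proper (Adj G) c) x y nodes
      nodes-unique : Unique nodes
      nodes-in     : All (_∈ₛ S) nodes

  route-parity : ∀ {S c x y} → c x ≡ true → (ρ : Route S c x y) → odd (length (Route.nodes ρ)) ≡ c y
  route-parity {c = c} {x} {y} cx ρ = begin
    odd (length (Route.nodes ρ)) ≡⟨ Proper-parity (Route.route ρ) ⟩
    not (c x xor c y)            ≡⟨ cong (λ b → not (b xor c y)) cx ⟩
    not (not (c y))              ≡⟨ not-involutive (c y) ⟩
    c y                          ∎
    where open ≡-Reasoning

  record Linkage (S : Subset n) (c : V → Bool) (a b : V) : Set where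
    field
      from-u : Route S c u a
      from-v : Route S c v b
      apart  : Disjoint (Route.nodes from-u) (Route.nodes from-v)

  -- The cycle u ⋯ a ⋯ b′ ∼ b ⋯ v ∼ u, whose bridge a ⋯ b′ runs outside S.
  module Bridge {S c a b b′ ms} (L : Linkage S c a b) (bridge : Path (Adj G) a b′ (a ∷ ms))
                (b′∼b : Adj G b′ b) (ms-unique : Unique ms) (ms∉S : All (_∉ₛ S) ms) where
    open Linkage L
    module A = Route from-u
    module B = Route from-v

    nodes : List V
    nodes = A.nodes ++ (ms ++ reverse B.nodes)

    path : Path (Adj G) u v nodes
    path = Path-++ (Path-map proj₁ A.route)
             (Path-++ bridge (b′∼b ∷ Path-reverse (adj-flip G) (Path-map proj₁ B.route)))

    nodes-unique : Unique nodes
    nodes-unique = ++⁺ A.nodes-unique (++⁺ ms-unique (Unique-reverse B.nodes-unique) ms#B) A#msB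
      where
        ms#B : Disjoint ms (reverse B.nodes)
        ms#B (x∈ms , x∈B) = All.lookup ms∉S x∈ms (All.lookup B.nodes-in (reverse⁻ x∈B))
        A#msB : Disjoint A.nodes (ms ++ reverse B.nodes)
        A#msB (x∈A , x∈msB) with ∈-++⁻ ms x∈msB
        ... | inj₁ x∈ms = All.lookup ms∉S x∈ms (All.lookup A.nodes-in x∈A)
        ... | inj₂ x∈B  = apart (x∈A , reverse⁻ x∈B)

    length-nodes : length nodes ≡ length A.nodes + (length ms + length B.nodes)
    length-nodes = trans (length-++ A.nodes)
      (cong (length A.nodes +_) (trans (length-++ ms) (cong (length ms +_) (length-reverse B.nodes))))

    length≥3 : (a ≡ u → b ≡ v → 1 ≤ length ms) → 3 ≤ length nodes
    length≥3 nontrivial = subst (3 ≤_) (sym length-nodes)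
                                (3≤l+[m+r] (Path-length A.route) (Path-length B.route) some-long)
      where
        some-long : 2 ≤ length A.nodes ⊎ 1 ≤ length ms ⊎ 2 ≤ length B.nodes
        some-long with a ≟ u | b ≟ v
        ... | no a≢u  | _       = inj₁ (Path-length-≢ A.route (a≢u ∘ sym))
        ... | yes _   | no b≢v  = inj₂ (inj₂ (Path-length-≢ B.route (b≢v ∘ sym)))
        ... | yes a≡u | yes b≡v = inj₂ (inj₁ (nontrivial a≡u b≡v))

    parity : c u ≡ true → c v ≡ true → odd (length nodes) ≡ c a xor odd (length ms) xor c b
    parity cu cv = begin
      odd (length nodes)
        ≡⟨ cong odd length-nodes ⟩
      odd (length A.nodes + (length ms + length B.nodes))
        ≡⟨ odd-+ (length A.nodes) _ ⟩
      odd (length A.nodes) xor odd (length ms + length B.nodes)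
        ≡⟨ cong (odd (length A.nodes) xor_) (odd-+ (length ms) _) ⟩
      odd (length A.nodes) xor odd (length ms) xor odd (length B.nodes)
        ≡⟨ cong₂ (λ p q → p xor odd (length ms) xor q) (route-parity cu from-u) (route-parity cv from-v) ⟩
      c a xor odd (length ms) xor c b
        ∎
      where open ≡-Reasoning

  bridge-cycle : ∀ {S c a b b′ ms} → c u ≡ true → c v ≡ true → Linkage S c a b →
                 Path (Adj G) a b′ (a ∷ ms) → Adj G b′ b → Unique ms → All (_∉ₛ S) ms →
                 (a ≡ u → b ≡ v → 1 ≤ length ms) → c a xor odd (length ms) xor c b ≡ false →
                 EvenCycleThrough
  bridge-cycle cu cv L bridge b′∼b ms-unique ms∉S nontrivial even =
    even-cycle path nodes-unique (length≥3 nontrivial) (trans (parity cu cv) even)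
    where open Bridge L bridge b′∼b ms-unique ms∉S

  Linkable : Subset n → (V → Bool) → V → V → Set
  Linkable S c a b = Linkage S c a b ⊎ Linkage S c b a

  record WellLinked (S : Subset n) (c : V → Bool) : Set where
    field
      u∈S      : u ∈ₛ S
      v∈S      : v ∈ₛ S
      u-true   : c u ≡ true
      v-true   : c v ≡ true
      linkable : ∀ {a b} → a ∈ₛ S → b ∈ₛ S → a ≢ b → Linkable S c a b

  record Ear (S : Subset n) : Set where
    field
      {s t z w}    : V
      s∈S          : s ∈ₛ S
      t∈S          : t ∈ₛ S
      s≢t          : s ≢ t
      inner        : List V
      inner-path   : Path (Adj G) z w inner
      inner-unique : Unique inner
      inner∉S      : All (_∉ₛ S) inner
      s∼z          : Adj G s z
      w∼t          : Adj G w t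

  Ear-flip : ∀ {S} → Ear S → Ear S
  Ear-flip E = record
    { s∈S = t∈S ; t∈S = s∈S ; s≢t = s≢t ∘ sym
    ; inner        = reverse inner ; inner-path = Path-reverse (adj-flip G) inner-path
    ; inner-unique = Unique-reverse inner-unique
    ; inner∉S      = All.tabulate (All.lookup inner∉S ∘ reverse⁻)
    ; s∼z          = adj-flip G w∼t ; w∼t = adj-flip G s∼z }
    where open Ear E

  ear-parity : ∀ {S} → (V → Bool) → Ear S → Bool
  ear-parity c E = c s xor odd (length inner) xor c t
    where open Ear E

  ear-parity-flip : ∀ {S} c (E : Ear S) → ear-parity c (Ear-flip E) ≡ ear-parity c E
  ear-parity-flip c E = begin
    c t xor odd (length (reverse inner)) xor c s ≡⟨ cong (λ m → c t xor odd m xor c s)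
                                                         (length-reverse inner) ⟩
    c t xor odd (length inner) xor c s           ≡⟨ xor-comm (c t) _ ⟩
    (odd (length inner) xor c s) xor c t         ≡⟨ cong (_xor c t) (xor-comm (odd (length inner)) (c s)) ⟩
    (c s xor odd (length inner)) xor c t         ≡⟨ xor-assoc (c s) _ _ ⟩
    c s xor odd (length inner) xor c t           ∎
    where open Ear E
          open ≡-Reasoning

  ear-cycle : ∀ {S c} → c u ≡ true → c v ≡ true → (E : Ear S) → Linkage S c (Ear.s E) (Ear.t E) →
              ear-parity c E ≡ false → EvenCycleThrough
  ear-cycle cu cv E L even =
    bridge-cycle cu cv L (s∼z ∷ inner-path) w∼t inner-unique inner∉S (λ _ _ → Path-length inner-path) even
    where open Ear E

  flip-proper : ∀ {c x y} → Proper (Adj G) c x y → Proper (Adj G) c y x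
  flip-proper (x∼y , cx≢cy) = adj-flip G x∼y , cx≢cy ∘ sym

  -- When the cycle through the ear would be odd, colouring the ear alternately keeps S ∪ ear
  -- well linked.
  module Extension {S c} (I : WellLinked S c) (E : Ear S) (odd-ear : ear-parity c E ≡ true) where
    open WellLinked I
    open Ear E

    c′ : V → Bool
    c′ = alternate _≟_ c (not (c s)) inner

    S′ : Subset n
    S′ = S ∪ fromList inner

    S⊆S′ : ∀ {x} → x ∈ₛ S → x ∈ₛ S′
    S⊆S′ = p⊆p∪q (fromList inner)

    inner⊆S′ : ∀ {x} → x ∈ inner → x ∈ₛ S′
    inner⊆S′ = q⊆p∪q S (fromList inner) ∘ ∈-fromList⁺

    S′-cases : ∀ {x} → x ∈ₛ S′ → x ∈ₛ S ⊎ x ∈ inner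
    S′-cases x∈S′ = Sum.map₂ ∈-fromList⁻ (x∈p∪q⁻ S (fromList inner) x∈S′)

    inner-outside : ∀ {x} → x ∈ inner → x ∉ₛ S
    inner-outside = All.lookup inner∉S

    apart-from-S : ∀ {xs ys} → All (_∈ₛ S) xs → ys ⊆ inner → Disjoint xs ys
    apart-from-S xs∈S ys⊆inner (x∈xs , x∈ys) = inner-outside (ys⊆inner x∈ys) (All.lookup xs∈S x∈xs)

    c′≡c : ∀ {x} → x ∈ₛ S → c′ x ≡ c x
    c′≡c x∈S = alternate-∉ _≟_ inner (λ x∈inner → inner-outside x∈inner x∈S)

    inner-proper : Path (Proper (Adj G) c′) z w inner
    inner-proper = alternate-proper _≟_ inner-path inner-unique

    c′z : c′ z ≡ not (c s)
    c′z = alternate-start _≟_ inner-path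

    s∼z′ : Proper (Adj G) c′ s z
    s∼z′ = s∼z , λ eq → not-¬ refl (trans (sym (c′≡c s∈S)) (trans eq c′z))

    w∼t′ : Proper (Adj G) c′ w t
    w∼t′ = w∼t , λ eq →
      true≢false (trans (sym differ) (trans (cong (_xor c t) (trans eq (c′≡c t∈S))) (xor-same (c t))))
      where
        open ≡-Reasoning
        differ : c′ w xor c t ≡ true
        differ = begin
          c′ w xor c t
            ≡⟨ cong (_xor c t) (xor-not-not (c s) (c′ w)) ⟨
          (c s xor not (not (c s) xor c′ w)) xor c t
            ≡⟨ cong (λ b → (c s xor not (b xor c′ w)) xor c t) c′z ⟨
          (c s xor not (c′ z xor c′ w)) xor c t
            ≡⟨ cong (λ b → (c s xor b) xor c t) (Proper-parity inner-proper) ⟨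
          (c s xor odd (length inner)) xor c t
            ≡⟨ xor-assoc (c s) _ _ ⟩
          c s xor odd (length inner) xor c t
            ≡⟨ odd-ear ⟩
          true
            ∎

    -- K records where a segment was cut from, so that disjointness of segments can be tracked.
    record Segment (x α : V) (K : List V) : Set where
      field
        extra        : List V
        extra-path   : Path (Proper (Adj G) c′) x α (x ∷ extra)
        extra-unique : Unique extra
        extra⊆K      : extra ⊆ K

    no-segment : ∀ {x} → Segment x x []
    no-segment = record { extra = [] ; extra-path = stop ; extra-unique = [] ; extra⊆K = λ () }

    segment : ∀ {x y α ys K} → Proper (Adj G) c′ x y → Path (Proper (Adj G) c′) y α ys → ys ⊆ K →
              Segment x α K
    segment x∼y p ys⊆K with loop-erase _≟_ p
    ... | zs , q , zs-unique , zs⊆ys =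
      record { extra = zs ; extra-path = x∼y ∷ q ; extra-unique = zs-unique ; extra⊆K = ys⊆K ∘ zs⊆ys }

    from-s : ∀ {α ys} → Path (Proper (Adj G) c′) z α ys → Segment s α ys
    from-s p = segment s∼z′ p id

    from-t : ∀ {β ys} → Path (Proper (Adj G) c′) β w ys → Segment t β ys
    from-t p = segment (flip-proper {c′} w∼t′) (Path-reverse (flip-proper {c′}) p) reverse⁻

    recolour : ∀ {a b} → a ∈ₛ S → b ∈ₛ S → Proper (Adj G) c a b → Proper (Adj G) c′ a b
    recolour a∈S b∈S (a∼b , ca≢cb) = a∼b , λ eq → ca≢cb (trans (sym (c′≡c a∈S)) (trans eq (c′≡c b∈S)))

    extend-route : ∀ {x a α K} → K ⊆ inner → Route S c x a → Segment a α K → Route S′ c′ x α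
    extend-route K⊆inner ρ σ = record
      { nodes        = nodes ++ extra
      ; route        = Path-++ (Path-mapᴾ recolour nodes-in route) extra-path
      ; nodes-unique = ++⁺ nodes-unique extra-unique (apart-from-S nodes-in (K⊆inner ∘ extra⊆K))
      ; nodes-in     = All-++⁺ (All.map S⊆S′ nodes-in) (All.tabulate (inner⊆S′ ∘ K⊆inner ∘ extra⊆K))
      }
      where open Route ρ
            open Segment σ

    extend-linkage : ∀ {a b α β K K′} → K ⊆ inner → K′ ⊆ inner → Disjoint K K′ →
                     Linkage S c a b → Segment a α K → Segment b β K′ → Linkage S′ c′ α β
    extend-linkage K⊆inner K′⊆inner K#K′ L σ τ = record
      { from-u = extend-route K⊆inner from-u σ ; from-v = extend-route K′⊆inner from-v τ ; apart = apart′ }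
      where
        open Linkage L
        module U = Route from-u
        module W = Route from-v
        module σ = Segment σ
        module τ = Segment τ
        apart′ : Disjoint (U.nodes ++ σ.extra) (W.nodes ++ τ.extra)
        apart′ (x∈ , x∈′) with ∈-++⁻ U.nodes x∈ | ∈-++⁻ W.nodes x∈′
        ... | inj₁ x∈U | inj₁ x∈W = apart (x∈U , x∈W)
        ... | inj₁ x∈U | inj₂ x∈τ = apart-from-S U.nodes-in (K′⊆inner ∘ τ.extra⊆K) (x∈U , x∈τ)
        ... | inj₂ x∈σ | inj₁ x∈W = apart-from-S W.nodes-in (K⊆inner ∘ σ.extra⊆K) (x∈W , x∈σ)
        ... | inj₂ x∈σ | inj₂ x∈τ = K#K′ (σ.extra⊆K x∈σ , τ.extra⊆K x∈τ)

    extend : ∀ {a b α β K K′} → K ⊆ inner → K′ ⊆ inner → Disjoint K K′ →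
             Linkable S c a b → Segment a α K → Segment b β K′ → Linkable S′ c′ α β
    extend K⊆ K′⊆ K#K′ (inj₁ L) σ τ = inj₁ (extend-linkage K⊆ K′⊆ K#K′ L σ τ)
    extend K⊆ K′⊆ K#K′ (inj₂ L) σ τ = inj₂ (extend-linkage K′⊆ K⊆ (λ (x∈ , x∈′) → K#K′ (x∈′ , x∈)) L τ σ)

    base : Linkable S c s t
    base = linkable s∈S t∈S s≢t

    old-old : ∀ {a b} → a ∈ₛ S → b ∈ₛ S → a ≢ b → Linkable S′ c′ a b
    old-old a∈S b∈S a≢b = extend (λ ()) (λ ()) (λ { (() , _) }) (linkable a∈S b∈S a≢b) no-segment no-segment

    new-old : ∀ {α q} → α ∈ inner → q ∈ₛ S → α ≢ q → Linkable S′ c′ α q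
    new-old {q = q} α∈ q∈S α≢q with q ≟ s
    ... | yes refl with Path-suffix inner-proper α∈
    ...   | zs , ys , inner≡ , p =
      swap (extend (λ ()) (λ y∈ → subst (_ ∈_) (sym inner≡) (∈-++⁺ʳ zs y∈)) (λ { (() , _) })
                   base no-segment (from-t p))
    new-old α∈ q∈S α≢q | no q≢s with Path-prefix inner-proper α∈
    ... | ys , p , ys⊆inner =
      extend ys⊆inner (λ ()) (λ { (_ , ()) }) (linkable s∈S q∈S (q≢s ∘ sym)) (from-s p) no-segment

    new-new : ∀ {α β} → α ∈ inner → β ∈ inner → α ≢ β → Linkable S′ c′ α β
    new-new α∈ β∈ α≢β = Sum.[ extend-separated , swap ∘ extend-separated ]
                          (separate inner-proper inner-unique α∈ β∈ α≢β)
      where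
        extend-separated : ∀ {α β} → Separation z w α β inner → Linkable S′ c′ α β
        extend-separated sep = extend front⊆ back⊆ apart base (from-s front-path) (from-t back-path)
          where open Separation sep

    linkable′ : ∀ {a b} → a ∈ₛ S′ → b ∈ₛ S′ → a ≢ b → Linkable S′ c′ a b
    linkable′ a∈ b∈ a≢b with S′-cases a∈ | S′-cases b∈
    ... | inj₁ a∈S | inj₁ b∈S = old-old a∈S b∈S a≢b
    ... | inj₂ a∈J | inj₁ b∈S = new-old a∈J b∈S a≢b
    ... | inj₁ a∈S | inj₂ b∈J = swap (new-old b∈J a∈S (a≢b ∘ sym))
    ... | inj₂ a∈J | inj₂ b∈J = new-new a∈J b∈J a≢b

    well-linked : WellLinked S′ c′
    well-linked = record
      { u∈S = S⊆S′ u∈S ; v∈S = S⊆S′ v∈S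
      ; u-true   = trans (c′≡c u∈S) u-true ; v-true = trans (c′≡c v∈S) v-true
      ; linkable = linkable′ }

    S⊂S′ : S ⊂ S′
    S⊂S′ = S⊆S′ , z , inner⊆S′ (start∈ inner-path) , inner-outside (start∈ inner-path)

  ear-step : ∀ {S c} → WellLinked S c → Ear S →
             EvenCycleThrough ⊎ Σ (Subset n) λ S′ → S ⊂ S′ × Σ (V → Bool) (WellLinked S′)
  ear-step {c = c} I E with ear-parity c E in parity
  ... | true  = inj₂ (S′ , S⊂S′ , c′ , well-linked)
    where open Extension I E parity
  ... | false with WellLinked.linkable I (Ear.s∈S E) (Ear.t∈S E) (Ear.s≢t E)
  ...   | inj₁ L = inj₁ (ear-cycle (WellLinked.u-true I) (WellLinked.v-true I) E L parity)
  ...   | inj₂ L = inj₁ (ear-cycle (WellLinked.u-true I) (WellLinked.v-true I) (Ear-flip E) L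
                                   (trans (ear-parity-flip c E) parity))

  Defect : (V → Bool) → V → V → Set
  Defect c x y = Adj G x y × c x ≡ c y × ¬ (x ≡ u × y ≡ v) × ¬ (x ≡ v × y ≡ u)

  defect? : ∀ c x y → Dec (Defect c x y)
  defect? c x y = T? (adj G x y) ×-dec (c x Bool.≟ c y) ×-dec
                  ¬? (x ≟ u ×-dec y ≟ v) ×-dec ¬? (x ≟ v ×-dec y ≟ u)

  defect-cycle : ∀ {S c x y} → WellLinked S c → Linkable S c x y → Defect c x y → EvenCycleThrough
  defect-cycle {c = c} I linked (x∼y , cx≡cy , ¬uv , ¬vu) =
    Sum.[ chord x∼y (λ x≡u y≡v → ⊥-elim (¬uv (x≡u , y≡v))) cx≡cy
        , chord (adj-flip G x∼y) (λ y≡u x≡v → ⊥-elim (¬vu (x≡v , y≡u))) (sym cx≡cy) ] linked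
    where
      open WellLinked I
      chord : ∀ {a b S} → Adj G a b → (a ≡ u → b ≡ v → 1 ≤ 0) → c a ≡ c b → Linkage S c a b →
              EvenCycleThrough
      chord {a} a∼b not-uv ca≡cb L = bridge-cycle u-true v-true L stop a∼b [] [] not-uv
                                       (trans (cong (c a xor_) (sym ca≡cb)) (xor-same (c a)))

  spanning : ∀ {S c} → WellLinked S c → (∀ x → x ∈ₛ S) → EvenCycleThrough ⊎ ProperExcept G u v c
  spanning {S} {c} I everywhere with any? (λ x → any? (defect? c x))
  ... | yes (x , y , defect) =
    inj₁ (defect-cycle I (linkable (everywhere x) (everywhere y) (adj⇒≢ G (proj₁ defect))) defect)
    where open WellLinked I
  ... | no no-defect = inj₂ record { u-true = u-true ; v-true = v-true ; only-uv = only-uv }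
    where
      open WellLinked I
      only-uv : ∀ {x y} → Adj G x y → c x ≡ c y → (x ≡ u × y ≡ v) ⊎ (x ≡ v × y ≡ u)
      only-uv {x} {y} x∼y cx≡cy with x ≟ u ×-dec y ≟ v | x ≟ v ×-dec y ≟ u
      ... | yes uv′ | _      = inj₁ uv′
      ... | no _    | yes vu = inj₂ vu
      ... | no ¬uv  | no ¬vu = ⊥-elim (no-defect (x , y , x∼y , cx≡cy , ¬uv , ¬vu))

  walk-path : ∀ {x y} (W : Walk G x y) → Path (Adj G) x y (verts W)
  walk-path W = Linked⇒Path (verts W) (start W) (end W) (linked W)

  another-in : ∀ {S} → u ∈ₛ S → v ∈ₛ S → ∀ s → Σ V λ t → t ∈ₛ S × t ≢ s
  another-in u∈S v∈S s with s ≟ u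
  ... | yes refl = v , v∈S , u≢v ∘ sym
  ... | no s≢u   = u , u∈S , s≢u ∘ sym

  S₀ : Subset n
  S₀ = ⁅ u ⁆ ∪ ⁅ v ⁆

  S₀-cases : ∀ {x} → x ∈ₛ S₀ → x ≡ u ⊎ x ≡ v
  S₀-cases x∈S₀ = Sum.map (x∈⁅y⁆⇒x≡y u) (x∈⁅y⁆⇒x≡y v) (x∈p∪q⁻ ⁅ u ⁆ ⁅ v ⁆ x∈S₀)

  initial : WellLinked S₀ (λ _ → true)
  initial = record { u∈S = u∈S₀ ; v∈S = v∈S₀ ; u-true = refl ; v-true = refl ; linkable = linkable₀ }
    where
      u∈S₀ = p⊆p∪q ⁅ v ⁆ (x∈⁅x⁆ u)
      v∈S₀ = q⊆p∪q ⁅ u ⁆ ⁅ v ⁆ (x∈⁅x⁆ v)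

      trivial-route : ∀ {x} → x ∈ₛ S₀ → Route S₀ (λ _ → true) x x
      trivial-route x∈S₀ =
        record { nodes = _ ∷ [] ; route = stop ; nodes-unique = [] ∷ [] ; nodes-in = x∈S₀ ∷ [] }

      uv-linkage : Linkage S₀ (λ _ → true) u v
      uv-linkage = record { from-u = trivial-route u∈S₀ ; from-v = trivial-route v∈S₀
                          ; apart = λ { (here refl , here u≡v) → u≢v u≡v } }

      linkable₀ : ∀ {a b} → a ∈ₛ S₀ → b ∈ₛ S₀ → a ≢ b → Linkable S₀ (λ _ → true) a b
      linkable₀ a∈S₀ b∈S₀ a≢b with S₀-cases a∈S₀ | S₀-cases b∈S₀
      ... | inj₁ refl | inj₁ refl = ⊥-elim (a≢b refl)
      ... | inj₁ refl | inj₂ refl = inj₁ uv-linkage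
      ... | inj₂ refl | inj₁ refl = inj₂ uv-linkage
      ... | inj₂ refl | inj₂ refl = ⊥-elim (a≢b refl)

  module _ (connected : Connected G) (connected-without : ∀ x → ConnectedAvoiding G (_≡ x)) where

    boundary-edge : ∀ {S x} → u ∈ₛ S → x ∉ₛ S → Σ V λ s → Σ V λ z → s ∈ₛ S × z ∉ₛ S × Adj G s z
    boundary-edge {S} {x} u∈S x∉S =
      entry , exit , entry-in , All.lookup prefix-out (end∈ prefix-path) , adj-flip G step
      where open Entry (first-entry (_∈ₛ? S) (walk-path (proj₁ (connected x u (λ ()) (λ ())))) x∉S u∈S)

    -- Return from z to S by a walk avoiding s, stopping at its first vertex in S.
    ear : ∀ {S s z} → u ∈ₛ S → v ∈ₛ S → s ∈ₛ S → z ∉ₛ S → Adj G s z → Ear S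
    ear {S} {s} {z} u∈S v∈S s∈S z∉S s∼z with another-in u∈S v∈S s
    ... | t₀ , t₀∈S , t₀≢s with connected-without s z t₀ (λ { refl → z∉S s∈S }) t₀≢s
    ...   | W , W-avoids-s with first-entry (_∈ₛ? S) (walk-path W) z∉S t₀∈S
    ...     | e with loop-erase _≟_ (Entry.prefix-path e)
    ...       | J , J-path , J-unique , J⊆ = record
      { s∈S = s∈S ; t∈S = entry-in ; s≢t = λ s≡t → All.lookup W-avoids-s entry∈ (sym s≡t)
      ; inner   = J ; inner-path = J-path ; inner-unique = J-unique
      ; inner∉S = All.tabulate (All.lookup prefix-out ∘ J⊆) ; s∼z = s∼z ; w∼t = step }
      where open Entry e

    grow : ∀ {S} → Acc _⊃_ S → ∀ {c} → WellLinked S c → EvenCycleThrough ⊎ Σ (V → Bool) (ProperExcept G u v)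
    grow {S} (acc larger) {c} I with all? (_∈ₛ? S)
    ... | yes everywhere = Sum.map₂ (c ,_) (spanning I everywhere)
    ... | no ¬everywhere with ¬∀⟶∃¬ n (_∈ₛ S) (_∈ₛ? S) ¬everywhere
    ...   | x , x∉S with boundary-edge (WellLinked.u∈S I) x∉S
    ...     | s , z , s∈S , z∉S , s∼z
            with ear-step I (ear (WellLinked.u∈S I) (WellLinked.v∈S I) s∈S z∉S s∼z)
    ...       | inj₁ cycle                   = inj₁ cycle
    ...       | inj₂ (S′ , S⊂S′ , c′ , I′) = grow (larger S⊂S′) I′

    even-cycle-or-proper-colouring : EvenCycleThrough ⊎ Σ (V → Bool) (ProperExcept G u v)
    even-cycle-or-proper-colouring = grow (⊃-wellFounded S₀) initial

theorem3 : ∀ {n} (G : Graph n) (k : ℕ) → TwoConnected G → 3 ≤ k →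
    (∀ v → k ∣ degree G v) →
    ∀ u v → Adj G u v →
    Σ (Cycle G) (λ c → EdgeOnCycle u v c × 2 ∣ cycleLength c)
theorem3 G k (_ , connected , connected-without) 3≤k k∣degree u v uv
  with EvenCycle.even-cycle-or-proper-colouring G u v uv connected connected-without
... | inj₁ cycle        = cycle
... | inj₂ (c , proper) = ⊥-elim (>⇒∤ 3≤k (ProperExcept⇒∣2 G uv proper k∣degree))
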